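{- The map $\Upsilon_n$ from the set of naive EGK data of length $n$ to the set of EGK data of length $n$ is surjective: for every EGK datum $G$ of length $n$ there is a naive EGK datum $H$ of length $n$ with $\Upsilon_n(H)=G$.
   Context: A naive EGK datum of length $n$ is $(a_1,\dots,a_n;\varepsilon_1,\dots,\varepsilon_n)\in\mathbb{Z}_{\ge0}^n\times\{0,1,-1\}^n$ with (N1) $a_1\le\cdots\le a_n$; (N2) for $i$ even, $\varepsilon_i\ne0$ iff $a_1+\dots+a_i$ is even; (N3) for $i$ odd, $\varepsilon_i\neq0$; (N4) $\varepsilon_1=1$; (N5) if $i\ge3$ is odd and $a_1+\dots+a_{i-1}$ is even, then $\varepsilon_i=\varepsilon_{i-2}\varepsilon_{i-1}^{a_i+a_{i-1}}$. An EGK datum of length $n$ is $(n_1,\dots,n_r;m_1,\dots,m_r;\zeta_1,\dots,\zeta_r)\in\mathbb{Z}_{>0}^r\times\mathbb{Z}_{\ge0}^r\times\{0,1,-1\}^r$ (any $r\ge1$), with $n^\ast_s=n_1+\dots+n_s$, such that (E1) $n^\ast_r=n$ and $m_1<\dots<m_r$; (E2) if $n^\ast_s$ is even, $\zeta_s\ne0$ iff $m_1n_1+\dots+m_sn_s$ is even; (E3) if $n^\ast_s$ is odd, then $\zeta_s\ne0$, and (a) if $n^\ast_i$ is even for all $i<s$, then $\zeta_s=\zeta_1^{m_1+m_2}\cdots\zeta_{s-1}^{m_{s-1}+m_s}$; (b) if $m_1n_1+\dots+m_{s-1}n_{s-1}+m_s(n_s-1)$ is even and $n^\ast_i$ is odd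 for some $i<s$, then with $t<s$ the largest such $i$, $\zeta_s=\zeta_t\zeta_{t+1}^{m_{t+1}+m_{t+2}}\cdots\zeta_{s-1}^{m_{s-1}+m_s}$. $\Upsilon_n$ sends a naive EGK datum $(a_1,\dots,a_n;\varepsilon_1,\dots,\varepsilon_n)$ to $(n_1,\dots,n_r;m_1,\dots,m_r;\zeta_1,\dots,\zeta_r)$, where $m_1<\dots<m_r$ are the distinct values among the $a_i$, $n_s=\#\{i:a_i=m_s\}$, and $\zeta_s=\varepsilon_{n_1+\dots+n_s}$ (this is an EGK datum). -}

module Defs where

open import Data.Nat using (ℕ; zero; suc; _+_; _*_; _∸_; _≤_; _<_)
open import Data.Nat.Divisibility using (_∣_)
open import Data.Integer as ℤ using (ℤ; +_; -[1+_])
open import Data.Vec using (Vec; []; _∷_; toList)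
open import Data.List using (List; length; filter; take)
open import Data.Nat.ListAction using (sum)
open import Data.Product using (Σ; ∃; _×_; _,_)
open import Data.Sum using (_⊎_)
open import Relation.Nullary using (¬_)
open import Relation.Binary.PropositionalEquality using (_≡_; _≢_)
open import Function.Bundles using (_⇔_)
import Data.Nat as ℕ

Even : ℕ → Set
Even k = 2 ∣ k

Odd : ℕ → Set
Odd k = ¬ Even k

-- 1-based lookup with a default value outside the range 1..n
-- (only ever used with indices in range).
get : ∀ {A : Set} {n} → A → Vec A n → ℕ → A
get d []       _             = d
get d (x ∷ xs) zero          = d
get d (x ∷ xs) (suc zero)    = x
get d (x ∷ xs) (suc (suc k)) = get d xs (suc k)

IsSign : ℤ → Set
IsSign e = (e ≡ + 0) ⊎ ((e ≡ + 1) ⊎ (e ≡ -[1+ 0 ]))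

prodFrom : (ℕ → ℤ) → ℕ → ℕ → ℤ
prodFrom f lo zero    = + 1
prodFrom f lo (suc k) = f lo ℤ.* prodFrom f (suc lo) k

psum : ∀ {n} → Vec ℕ n → ℕ → ℕ
psum a i = sum (take i (toList a))

record NaiveEGK (n : ℕ) : Set where
  field
    a : Vec ℕ n
    ε : Vec ℤ n
  aᵢ : ℕ → ℕ
  aᵢ = get 0 a
  εᵢ : ℕ → ℤ
  εᵢ = get (+ 0) ε
  field
    signs : ∀ i → 1 ≤ i → i ≤ n → IsSign (εᵢ i)
    N1 : ∀ i → 1 ≤ i → i < n → aᵢ i ≤ aᵢ (suc i)
    N2 : ∀ i → 1 ≤ i → i ≤ n → Even i → (εᵢ i ≢ + 0 ⇔ Even (psum a i))
    N3 : ∀ i → 1 ≤ i → i ≤ n → Odd i → εᵢ i ≢ + 0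
    N4 : 1 ≤ n → εᵢ 1 ≡ + 1
    N5 : ∀ i → 3 ≤ i → i ≤ n → Odd i → Even (psum a (i ∸ 1)) →
         εᵢ i ≡ εᵢ (i ∸ 2) ℤ.* (εᵢ (i ∸ 1) ℤ.^ (aᵢ i + aᵢ (i ∸ 1)))

wsumV : ∀ {r} → Vec ℕ r → Vec ℕ r → ℕ → ℕ
wsumV ms ns zero    = 0
wsumV ms ns (suc s) = wsumV ms ns s + get 0 ms (suc s) * get 0 ns (suc s)

record EGK (n : ℕ) : Set where
  field
    r  : ℕ
    r≥1 : 1 ≤ r
    ns : Vec ℕ r
    ms : Vec ℕ r
    ζs : Vec ℤ r
  nᵢ : ℕ → ℕ
  nᵢ = get 0 ns
  mᵢ : ℕ → ℕ
  mᵢ = get 0 ms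
  ζᵢ : ℕ → ℤ
  ζᵢ = get (+ 0) ζs
  nstar : ℕ → ℕ
  nstar s = psum ns s
  wsum : ℕ → ℕ
  wsum = wsumV ms ns
  pw : ℕ → ℤ
  pw j = ζᵢ j ℤ.^ (mᵢ j + mᵢ (suc j))
  field
    ns-pos : ∀ s → 1 ≤ s → s ≤ r → 0 < nᵢ s
    signs  : ∀ s → 1 ≤ s → s ≤ r → IsSign (ζᵢ s)
    E1-len : nstar r ≡ n
    E1-inc : ∀ s → 1 ≤ s → s < r → mᵢ s < mᵢ (suc s)
    E2 : ∀ s → 1 ≤ s → s ≤ r → Even (nstar s) →
         (ζᵢ s ≢ + 0 ⇔ Even (wsum s))
    E3 : ∀ s → 1 ≤ s → s ≤ r → Odd (nstar s) → ζᵢ s ≢ + 0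
    E3a : ∀ s → 1 ≤ s → s ≤ r → Odd (nstar s) →
          (∀ i → 1 ≤ i → i < s → Even (nstar i)) →
          ζᵢ s ≡ prodFrom pw 1 (s ∸ 1)
    E3b : ∀ s → 1 ≤ s → s ≤ r → Odd (nstar s) →
          Even (wsum (s ∸ 1) + mᵢ s * (nᵢ s ∸ 1)) →
          ∀ t → 1 ≤ t → t < s → Odd (nstar t) →
          (∀ i → t < i → i < s → Even (nstar i)) →
          ζᵢ s ≡ ζᵢ t ℤ.* prodFrom pw (suc t) (s ∸ suc t)

-- Υ_n(H) = G, spelled out from the definition of Υ_n:
-- m_1 < ... < m_r are exactly the distinct values among the a_i,
-- n_s = #{ i : a_i = m_s }, and ζ_s = ε_{n_1 + ... + n_s}.

count : ∀ {n} → Vec ℕ n → ℕ → ℕ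
count a v = length (filter (λ x → x ℕ.≟ v) (toList a))

record Υ≡ {n : ℕ} (H : NaiveEGK n) (G : EGK n) : Set where
  open NaiveEGK H
  open EGK G
  field
    values-inc : ∀ s → 1 ≤ s → s < r → mᵢ s < mᵢ (suc s)
    values-⊆   : ∀ s → 1 ≤ s → s ≤ r → ∃ λ i → 1 ≤ i × i ≤ n × aᵢ i ≡ mᵢ s
    values-⊇   : ∀ i → 1 ≤ i → i ≤ n → ∃ λ s → 1 ≤ s × s ≤ r × aᵢ i ≡ mᵢ s
    mult       : ∀ s → 1 ≤ s → s ≤ r → nᵢ s ≡ count a (mᵢ s)
    signs-eq   : ∀ s → 1 ≤ s → s ≤ r → ζᵢ s ≡ εᵢ (nstar s)

{-# OPTIONS --safe #-}
-- Spread each block s of G over the positions n*_{s-1} < k ≤ n*_s, so a_k = m_s, and take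
-- ε_{n*_s} = ζ_s.  Inside a block, an even position gets the sign forced by (N2) and an odd
-- position gets the unit ω s that (N5) propagates from the last odd block boundary; every
-- constraint (N1)-(N5) lands either inside one block, where it holds by construction, or on
-- a block end, where it becomes one of (E1)-(E3).  Since the a_k are constant on blocks,
-- a_1 + ... + a_{n*_s} = m_1 n_1 + ... + m_s n_s, which is how the parity conditions match.
module Submission where

open import Defs
open import Data.Nat using (ℕ; zero; suc; _+_; _*_; _∸_; _≤_; _<_; z≤n; s≤s; _≤?_; _≟_; _≡ᵇ_)
open import Data.Nat.Properties
open import Data.Nat.Divisibility using (divides; _∣?_; _∣0; ∣m+n∣m⇒∣n; ∣1⇒≡1)
open import Data.Integer as ℤ using (ℤ; -[1+_]; 0ℤ; 1ℤ; -1ℤ)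
import Data.Integer.Properties as ℤP
open import Data.Vec using (Vec; []; _∷_)
open import Data.Product using (∃; _×_; _,_)
open import Data.Sum using (_⊎_; inj₁; inj₂)
open import Data.Bool using (true; false; if_then_else_)
open import Data.Unit using (tt)
open import Data.Empty using (⊥-elim)
open import Function using (_∘_)
open import Function.Bundles using (_⇔_; mk⇔; Equivalence)
open import Relation.Nullary using (¬_; Dec; yes; no)
open import Relation.Binary.PropositionalEquality

sumFrom : (ℕ → ℕ) → ℕ → ℕ → ℕ
sumFrom f lo zero    = 0
sumFrom f lo (suc k) = f lo + sumFrom f (suc lo) k

sumFrom-+ : ∀ f lo k l → sumFrom f lo (k + l) ≡ sumFrom f lo k + sumFrom f (lo + k) l
sumFrom-+ f lo zero    l = cong (λ i → sumFrom f i l) (sym (+-identityʳ lo))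
sumFrom-+ f lo (suc k) l = begin
  f lo + sumFrom f (suc lo) (k + l)                          ≡⟨ cong (f lo +_) (sumFrom-+ f (suc lo) k l) ⟩
  f lo + (sumFrom f (suc lo) k + sumFrom f (suc lo + k) l)   ≡⟨ sym (+-assoc (f lo) _ _) ⟩
  sumFrom f lo (suc k) + sumFrom f (suc lo + k) l            ≡⟨ cong (λ i → sumFrom f lo (suc k) + sumFrom f i l) (sym (+-suc lo k)) ⟩
  sumFrom f lo (suc k) + sumFrom f (lo + suc k) l            ∎
  where open ≡-Reasoning

sumFrom-const : ∀ {f c} lo k → (∀ j → lo ≤ j → j < lo + k → f j ≡ c) → sumFrom f lo k ≡ c * k
sumFrom-const {c = c} lo zero    _   = sym (*-zeroʳ c)
sumFrom-const {f} {c} lo (suc k) f≡c = begin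
  f lo + sumFrom f (suc lo) k ≡⟨ cong₂ _+_ (f≡c lo ≤-refl (m<m+n lo (s≤s z≤n))) (sumFrom-const (suc lo) k f≡c′) ⟩
  c + c * k                   ≡⟨ sym (*-suc c k) ⟩
  c * suc k                   ∎
  where
    open ≡-Reasoning
    f≡c′ : ∀ j → suc lo ≤ j → j < suc lo + k → f j ≡ c
    f≡c′ j lo<j j< = f≡c j (<⇒≤ lo<j) (subst (j <_) (sym (+-suc lo k)) j<)

fromFun : ∀ {A : Set} → (ℕ → A) → ℕ → (k : ℕ) → Vec A k
fromFun f lo zero    = []
fromFun f lo (suc k) = f lo ∷ fromFun f (suc lo) k

get-fromFun : ∀ {A : Set} (d : A) f lo {k} i → i < k → get d (fromFun f lo k) (suc i) ≡ f (lo + i)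
get-fromFun d f lo {suc k} zero    _         = cong f (sym (+-identityʳ lo))
get-fromFun d f lo {suc k} (suc i) (s≤s i<k) = trans (get-fromFun d f (suc lo) i i<k) (cong f (sym (+-suc lo i)))

get-fromFun₁ : ∀ {A : Set} (d : A) f {k i} → 1 ≤ i → i ≤ k → get d (fromFun f 1 k) i ≡ f i
get-fromFun₁ d f {i = suc i} _ i<k = get-fromFun d f 1 i i<k

psum-fromFun : ∀ f lo {k} i → i ≤ k → psum (fromFun f lo k) i ≡ sumFrom f lo i
psum-fromFun f lo zero    _         = refl
psum-fromFun f lo (suc i) (s≤s i≤k) = cong (f lo +_) (psum-fromFun f (suc lo) i i≤k)

psum-suc : ∀ {r} (v : Vec ℕ r) s → psum v (suc s) ≡ psum v s + get 0 v (suc s)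
psum-suc []      zero    = refl
psum-suc []      (suc s) = refl
psum-suc (x ∷ v) zero    = +-identityʳ x
psum-suc (x ∷ v) (suc s) = trans (cong (x +_) (psum-suc v s)) (sym (+-assoc x _ _))

indicator : ℕ → ℕ → ℕ
indicator x v = if x ≡ᵇ v then 1 else 0

indicator-refl : ∀ x → indicator x x ≡ 1
indicator-refl x with x ≡ᵇ x | ≡⇒≡ᵇ x x refl
... | true  | _  = refl
... | false | ()

indicator-≢ : ∀ {x v} → x ≢ v → indicator x v ≡ 0
indicator-≢ {x} {v} x≢v with x ≡ᵇ v | ≡ᵇ⇒≡ x v
... | true  | x≡v = ⊥-elim (x≢v (x≡v tt))
... | false | _   = refl

count-fromFun : ∀ f v lo k → count (fromFun f lo k) v ≡ sumFrom (λ j → indicator (f j) v) lo k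
count-fromFun f v lo zero    = refl
count-fromFun f v lo (suc k) with f lo ≡ᵇ v
... | true  = cong suc (count-fromFun f v (suc lo) k)
... | false = count-fromFun f v (suc lo) k

last-failure : ∀ {P : ℕ → Set} → (∀ i → Dec (P i)) → ∀ s →
               (∀ i → 1 ≤ i → i < s → P i) ⊎
               ∃ λ t → 1 ≤ t × t < s × ¬ P t × (∀ i → t < i → i < s → P i)
last-failure P? zero          = inj₁ (λ _ _ ())
last-failure P? (suc zero)    = inj₁ (λ i 1≤i i<1 → ⊥-elim (<⇒≱ i<1 1≤i))
last-failure {P} P? (suc (suc s)) with P? (suc s) | last-failure P? (suc s)
... | no ¬p | _ = inj₂ (suc s , s≤s z≤n , ≤-refl , ¬p , λ i s<i i<s → ⊥-elim (<⇒≱ i<s s<i))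
... | yes p | inj₁ all = inj₁ (extend p all)
  where
    extend : ∀ {Q : ℕ → Set} → P (suc s) → (∀ i → Q i → i < suc s → P i) → ∀ i → Q i → i < suc (suc s) → P i
    extend p below i q i< with m≤n⇒m<n∨m≡n (≤-pred i<)
    ... | inj₁ i<s = below i q i<s
    ... | inj₂ refl = p
... | yes p | inj₂ (t , 1≤t , t<s , ¬pt , after) =
  inj₂ (t , 1≤t , m<n⇒m<1+n t<s , ¬pt , extend p after)
  where
    extend : ∀ {Q : ℕ → Set} → P (suc s) → (∀ i → Q i → i < suc s → P i) → ∀ i → Q i → i < suc (suc s) → P i
    extend p below i q i< with m≤n⇒m<n∨m≡n (≤-pred i<)
    ... | inj₁ i<s = below i q i<s
    ... | inj₂ refl = p

prodFrom-snoc : ∀ f lo k → prodFrom f lo (suc k) ≡ prodFrom f lo k ℤ.* f (lo + k)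
prodFrom-snoc f lo zero    = trans (ℤP.*-identityʳ (f lo)) (trans (cong f (sym (+-identityʳ lo))) (sym (ℤP.*-identityˡ _)))
prodFrom-snoc f lo (suc k) = begin
  f lo ℤ.* prodFrom f (suc lo) (suc k)                  ≡⟨ cong (f lo ℤ.*_) (prodFrom-snoc f (suc lo) k) ⟩
  f lo ℤ.* (prodFrom f (suc lo) k ℤ.* f (suc lo + k))   ≡⟨ sym (ℤP.*-assoc (f lo) _ _) ⟩
  prodFrom f lo (suc k) ℤ.* f (suc lo + k)              ≡⟨ cong (λ i → prodFrom f lo (suc k) ℤ.* f i) (sym (+-suc lo k)) ⟩
  prodFrom f lo (suc k) ℤ.* f (lo + suc k)              ∎
  where open ≡-Reasoning

odd-1 : Odd 1
odd-1 2∣1 with ∣1⇒≡1 2∣1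
... | ()

even⊎even-suc : ∀ k → Even k ⊎ Even (suc k)
even⊎even-suc zero    = inj₁ (2 ∣0)
even⊎even-suc (suc k) with even⊎even-suc k
... | inj₁ (divides q eq) = inj₂ (divides (suc q) (cong (suc ∘ suc) eq))
... | inj₂ e              = inj₁ e

even-suc⇒odd : ∀ {k} → Even (suc k) → Odd k
even-suc⇒odd {k} e e′ = odd-1 (∣m+n∣m⇒∣n (subst Even (+-comm 1 k) e) e′)

odd-suc⇒even : ∀ {k} → Odd (suc k) → Even k
odd-suc⇒even {k} o with even⊎even-suc k
... | inj₁ e = e
... | inj₂ e = ⊥-elim (o e)

IsUnit : ℤ → Set
IsUnit x = x ≡ 1ℤ ⊎ x ≡ -1ℤ

unit-* : ∀ {x y} → IsUnit x → IsUnit y → IsUnit (x ℤ.* y)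
unit-* (inj₁ refl) (inj₁ refl) = inj₁ refl
unit-* (inj₁ refl) (inj₂ refl) = inj₂ refl
unit-* (inj₂ refl) (inj₁ refl) = inj₂ refl
unit-* (inj₂ refl) (inj₂ refl) = inj₁ refl

unit-^ : ∀ {x} → IsUnit x → ∀ e → IsUnit (x ℤ.^ e)
unit-^ u zero    = inj₁ refl
unit-^ u (suc e) = unit-* u (unit-^ u e)

unit⇒≢0 : ∀ {x} → IsUnit x → x ≢ 0ℤ
unit⇒≢0 (inj₁ refl) ()
unit⇒≢0 (inj₂ refl) ()

sign-≢0⇒unit : ∀ {x} → IsSign x → x ≢ 0ℤ → IsUnit x
sign-≢0⇒unit (inj₁ x≡0) x≢0 = ⊥-elim (x≢0 x≡0)
sign-≢0⇒unit (inj₂ u)   _   = u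

sign-^ : ∀ {x} → IsSign x → ∀ e → IsSign (x ℤ.^ e)
sign-^ (inj₂ u)    e       = inj₂ (unit-^ u e)
sign-^ (inj₁ refl) zero    = inj₂ (inj₁ refl)
sign-^ (inj₁ refl) (suc e) = inj₁ refl

toUnit : ℤ → ℤ
toUnit -[1+ 0 ] = -1ℤ
toUnit _        = 1ℤ

toUnit-unit : ∀ x → IsUnit (toUnit x)
toUnit-unit (ℤ.+ n)         = inj₁ refl
toUnit-unit -[1+ zero ]     = inj₂ refl
toUnit-unit -[1+ suc n ]    = inj₁ refl

toUnit-id : ∀ {x} → IsUnit x → toUnit x ≡ x
toUnit-id (inj₁ refl) = refl
toUnit-id (inj₂ refl) = refl

prodFrom-toUnit : ∀ f lo k → (∀ j → lo ≤ j → j < lo + k → IsSign (f j)) → prodFrom f lo k ≢ 0ℤ →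
                  prodFrom (toUnit ∘ f) lo k ≡ prodFrom f lo k
prodFrom-toUnit f lo zero    _    _  = refl
prodFrom-toUnit f lo (suc k) sign ≢0 =
  cong₂ ℤ._*_ (toUnit-id (sign-≢0⇒unit (sign lo ≤-refl (m<m+n lo (s≤s z≤n))) head≢0))
              (prodFrom-toUnit f (suc lo) k sign′ tail≢0)
  where
    head≢0 : f lo ≢ 0ℤ
    head≢0 f≡0 = ≢0 (cong (ℤ._* prodFrom f (suc lo) k) f≡0)
    tail≢0 : prodFrom f (suc lo) k ≢ 0ℤ
    tail≢0 p≡0 = ≢0 (trans (cong (f lo ℤ.*_) p≡0) (ℤP.*-zeroʳ (f lo)))
    sign′ : ∀ j → suc lo ≤ j → j < suc lo + k → IsSign (f j)
    sign′ j lo<j j< = sign j (<⇒≤ lo<j) (subst (j <_) (sym (+-suc lo k)) j<)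

evenSign : ℕ → ℤ
evenSign m with 2 ∣? m
... | yes _ = 1ℤ
... | no  _ = 0ℤ

evenSign-sign : ∀ m → IsSign (evenSign m)
evenSign-sign m with 2 ∣? m
... | yes _ = inj₂ (inj₁ refl)
... | no  _ = inj₁ refl

evenSign-even : ∀ {m} → Even m → evenSign m ≡ 1ℤ
evenSign-even {m} e with 2 ∣? m
... | yes _ = refl
... | no ¬e = ⊥-elim (¬e e)

evenSign-≢0⇔even : ∀ m → (evenSign m ≢ 0ℤ) ⇔ Even m
evenSign-≢0⇔even m with 2 ∣? m
... | yes e  = mk⇔ (λ _ → e) (λ _ ())
... | no  ¬e = mk⇔ (λ ≢0 → ⊥-elim (≢0 refl)) (λ e → ⊥-elim (¬e e))

module Construction {n : ℕ} (G : EGK n) where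
  open EGK G

  nstar-suc : ∀ s → nstar (suc s) ≡ nstar s + nᵢ (suc s)
  nstar-suc = psum-suc ns

  nstar-<-suc : ∀ {s} → s < r → nstar s < nstar (suc s)
  nstar-<-suc {s} s<r = subst (nstar s <_) (sym (nstar-suc s)) (m<m+n (nstar s) (ns-pos (suc s) (s≤s z≤n) s<r))

  nstar-mono-≤ : ∀ {s t} → s ≤ t → t ≤ r → nstar s ≤ nstar t
  nstar-mono-≤ {t = zero}  z≤n _   = ≤-refl
  nstar-mono-≤ {t = suc t} s≤t t<r with m≤n⇒m<n∨m≡n s≤t
  ... | inj₂ refl      = ≤-refl
  ... | inj₁ (s≤s s≤t′) = ≤-trans (nstar-mono-≤ s≤t′ (≤-trans (n≤1+n t) t<r)) (<⇒≤ (nstar-<-suc t<r))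

  nstar-mono-< : ∀ {s t} → s < t → t ≤ r → nstar s < nstar t
  nstar-mono-< {t = suc t} (s≤s s≤t) t<r = ≤-<-trans (nstar-mono-≤ s≤t (≤-trans (n≤1+n t) t<r)) (nstar-<-suc t<r)

  nstar≤n : ∀ {t} → t ≤ r → nstar t ≤ n
  nstar≤n t≤r = subst (_ ≤_) E1-len (nstar-mono-≤ t≤r ≤-refl)

  m-mono-< : ∀ {s t} → 1 ≤ s → s < t → t ≤ r → mᵢ s < mᵢ t
  m-mono-< {s} {suc t} 1≤s (s≤s s≤t) t<r with m≤n⇒m<n∨m≡n s≤t
  ... | inj₂ refl = E1-inc s 1≤s t<r
  ... | inj₁ s<t  = <-trans (m-mono-< 1≤s s<t (≤-trans (n≤1+n t) t<r)) (E1-inc t (≤-trans 1≤s (<⇒≤ s<t)) t<r)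

  m-mono-≤ : ∀ {s t} → 1 ≤ s → s ≤ t → t ≤ r → mᵢ s ≤ mᵢ t
  m-mono-≤ 1≤s s≤t t≤r with m≤n⇒m<n∨m≡n s≤t
  ... | inj₁ s<t  = <⇒≤ (m-mono-< 1≤s s<t t≤r)
  ... | inj₂ refl = ≤-refl

  record InBlock (k s : ℕ) : Set where
    constructor inBlock
    field
      1≤s     : 1 ≤ s
      s≤r     : s ≤ r
      start<k : nstar (s ∸ 1) < k
      k≤end   : k ≤ nstar s

  InBlock-last : ∀ {s} → 1 ≤ s → s ≤ r → InBlock (nstar s) s
  InBlock-last 1≤s s≤r = inBlock 1≤s s≤r (nstar-mono-< (s∸1<s 1≤s) s≤r) ≤-refl
    where
      s∸1<s : ∀ {s} → 1 ≤ s → s ∸ 1 < s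
      s∸1<s {suc s} _ = ≤-refl

  InBlock-mono : ∀ {i j s t} → InBlock i s → InBlock j t → i ≤ j → s ≤ t
  InBlock-mono {s = suc s} (inBlock _ s≤r start<i _) (inBlock _ _ _ j≤end) i≤j =
    ≮⇒≥ λ { (s≤s t≤s) → <⇒≱ start<i (≤-trans i≤j (≤-trans j≤end (nstar-mono-≤ t≤s (≤-trans (n≤1+n s) s≤r)))) }

  InBlock-unique : ∀ {k s t} → InBlock k s → InBlock k t → s ≡ t
  InBlock-unique b b′ = ≤-antisym (InBlock-mono b b′ ≤-refl) (InBlock-mono b′ b ≤-refl)

  lastBlockStartingBefore : ℕ → ℕ → ℕ
  lastBlockStartingBefore k zero    = 0
  lastBlockStartingBefore k (suc t) with k ≤? nstar t
  ... | yes _ = lastBlockStartingBefore k t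
  ... | no  _ = suc t

  lastBlockStartingBefore-InBlock : ∀ {k} t → t ≤ r → 1 ≤ k → k ≤ nstar t → InBlock k (lastBlockStartingBefore k t)
  lastBlockStartingBefore-InBlock zero _ 1≤k k≤0 with ≤-trans 1≤k k≤0
  ... | ()
  lastBlockStartingBefore-InBlock {k} (suc t) t<r 1≤k k≤end with k ≤? nstar t
  ... | yes k≤t = lastBlockStartingBefore-InBlock t (≤-trans (n≤1+n t) t<r) 1≤k k≤t
  ... | no  k≰t = inBlock (s≤s z≤n) t<r (≰⇒> k≰t) k≤end

  block : ℕ → ℕ
  block k = lastBlockStartingBefore k r

  block-InBlock : ∀ {k} → 1 ≤ k → k ≤ n → InBlock k (block k)
  block-InBlock 1≤k k≤n = lastBlockStartingBefore-InBlock r ≤-refl 1≤k (subst (_ ≤_) (sym E1-len) k≤n)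

  block-unique : ∀ {k s} → InBlock k s → block k ≡ s
  block-unique b@(inBlock _ s≤r start<k k≤end) =
    InBlock-unique (block-InBlock (≤-trans (s≤s z≤n) start<k) (≤-trans k≤end (nstar≤n s≤r))) b

  a : ℕ → ℕ
  a k = mᵢ (block k)

  a-InBlock : ∀ {k s} → InBlock k s → a k ≡ mᵢ s
  a-InBlock b = cong mᵢ (block-unique b)

  a-mono : ∀ {i j} → 1 ≤ i → i ≤ j → j ≤ n → a i ≤ a j
  a-mono 1≤i i≤j j≤n =
    m-mono-≤ (InBlock.1≤s bi) (InBlock-mono bi bj i≤j) (InBlock.s≤r bj)
    where
      bi = block-InBlock 1≤i (≤-trans i≤j j≤n)
      bj = block-InBlock (≤-trans 1≤i i≤j) j≤n

  prefix : ℕ → ℕ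
  prefix = sumFrom a 1

  blockSum : (ℕ → ℕ) → ℕ → ℕ
  blockSum g zero    = 0
  blockSum g (suc t) = blockSum g t + g (mᵢ (suc t)) * nᵢ (suc t)

  sum-within-block : ∀ g {t d} → t < r → d ≤ nᵢ (suc t) → sumFrom (g ∘ a) (suc (nstar t)) d ≡ g (mᵢ (suc t)) * d
  sum-within-block g {t} {d} t<r d≤n = sumFrom-const (suc (nstar t)) d λ j t<j j< →
    cong g (a-InBlock (inBlock (s≤s z≤n) t<r t<j
      (≤-trans (≤-pred j<) (≤-trans (+-monoʳ-≤ (nstar t) d≤n) (≤-reflexive (sym (nstar-suc t)))))))

  sum-to-nstar : ∀ g t → t ≤ r → sumFrom (g ∘ a) 1 (nstar t) ≡ blockSum g t
  sum-to-nstar g zero    _   = refl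
  sum-to-nstar g (suc t) t<r = begin
      sumFrom (g ∘ a) 1 (nstar (suc t))
    ≡⟨ cong (sumFrom (g ∘ a) 1) (nstar-suc t) ⟩
      sumFrom (g ∘ a) 1 (nstar t + nᵢ (suc t))
    ≡⟨ sumFrom-+ (g ∘ a) 1 (nstar t) _ ⟩
      sumFrom (g ∘ a) 1 (nstar t) + sumFrom (g ∘ a) (suc (nstar t)) (nᵢ (suc t))
    ≡⟨ cong₂ _+_ (sum-to-nstar g t (≤-trans (n≤1+n t) t<r)) (sum-within-block g t<r ≤-refl) ⟩
      blockSum g (suc t)
    ∎
    where open ≡-Reasoning

  blockSum-id : ∀ t → blockSum (λ x → x) t ≡ wsum t
  blockSum-id zero    = refl
  blockSum-id (suc t) = cong (_+ mᵢ (suc t) * nᵢ (suc t)) (blockSum-id t)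

  prefix-end : ∀ {t} → t ≤ r → prefix (nstar t) ≡ wsum t
  prefix-end {t} t≤r = trans (sum-to-nstar (λ x → x) t t≤r) (blockSum-id t)

  prefix-before-end : ∀ {s} → 1 ≤ s → s ≤ r → prefix (nstar s ∸ 1) ≡ wsum (s ∸ 1) + mᵢ s * (nᵢ s ∸ 1)
  prefix-before-end {suc t} _ t<r = begin
    prefix (nstar (suc t) ∸ 1)                           ≡⟨ cong (λ i → prefix (i ∸ 1)) (nstar-suc t) ⟩
    prefix (nstar t + nᵢ (suc t) ∸ 1)                    ≡⟨ cong prefix (+-∸-assoc (nstar t) (ns-pos (suc t) (s≤s z≤n) t<r)) ⟩
    prefix (nstar t + (nᵢ (suc t) ∸ 1))                  ≡⟨ sumFrom-+ a 1 (nstar t) _ ⟩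
    prefix (nstar t) + sumFrom a (suc (nstar t)) (nᵢ (suc t) ∸ 1)
      ≡⟨ cong₂ _+_ (prefix-end (≤-trans (n≤1+n t) t<r)) (sum-within-block (λ x → x) t<r (m∸n≤m _ 1)) ⟩
    wsum t + mᵢ (suc t) * (nᵢ (suc t) ∸ 1)               ∎
    where open ≡-Reasoning

  blockSum-indicator-below : ∀ {s t} → t < s → s ≤ r → blockSum (λ x → indicator x (mᵢ s)) t ≡ 0
  blockSum-indicator-below {t = zero}  _   _   = refl
  blockSum-indicator-below {t = suc t} t<s s≤r =
    cong₂ _+_ (blockSum-indicator-below (<-trans (n<1+n t) t<s) s≤r)
              (cong (_* nᵢ (suc t)) (indicator-≢ (<⇒≢ (m-mono-< (s≤s z≤n) t<s s≤r))))

  blockSum-indicator-from : ∀ {s t} → 1 ≤ s → s ≤ t → t ≤ r → blockSum (λ x → indicator x (mᵢ s)) t ≡ nᵢ s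
  blockSum-indicator-from {t = zero}  1≤s s≤0 _ with ≤-trans 1≤s s≤0
  ... | ()
  blockSum-indicator-from {s} {suc t} 1≤s s≤t t<r with m≤n⇒m<n∨m≡n s≤t
  ... | inj₂ refl = begin
      blockSum (λ x → indicator x (mᵢ s)) t + indicator (mᵢ s) (mᵢ s) * nᵢ s
    ≡⟨ cong₂ _+_ (blockSum-indicator-below ≤-refl t<r) (cong (_* nᵢ s) (indicator-refl (mᵢ s))) ⟩
      nᵢ s + 0
    ≡⟨ +-identityʳ (nᵢ s) ⟩
      nᵢ s
    ∎
    where open ≡-Reasoning
  ... | inj₁ (s≤s s≤t′) = begin
    blockSum (λ x → indicator x (mᵢ s)) t + indicator (mᵢ (suc t)) (mᵢ s) * nᵢ (suc t)
      ≡⟨ cong₂ _+_ (blockSum-indicator-from 1≤s s≤t′ (≤-trans (n≤1+n t) t<r))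
                   (cong (_* nᵢ (suc t)) (indicator-≢ (λ m≡ → <⇒≢ (m-mono-< 1≤s (s≤s s≤t′) t<r) (sym m≡)))) ⟩
    nᵢ s + 0 ≡⟨ +-identityʳ (nᵢ s) ⟩
    nᵢ s     ∎
    where open ≡-Reasoning

  count-a : ∀ {s} → 1 ≤ s → s ≤ r → count (fromFun a 1 n) (mᵢ s) ≡ nᵢ s
  count-a {s} 1≤s s≤r = begin
    count (fromFun a 1 n) (mᵢ s)                         ≡⟨ count-fromFun a (mᵢ s) 1 n ⟩
    sumFrom (λ j → indicator (a j) (mᵢ s)) 1 n           ≡⟨ cong (sumFrom _ 1) (sym E1-len) ⟩
    sumFrom (λ j → indicator (a j) (mᵢ s)) 1 (nstar r)   ≡⟨ sum-to-nstar (λ x → indicator x (mᵢ s)) r ≤-refl ⟩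
    blockSum (λ x → indicator x (mᵢ s)) r                ≡⟨ blockSum-indicator-from 1≤s s≤r ≤-refl ⟩
    nᵢ s                                                 ∎
    where open ≡-Reasoning

  pw-sign : ∀ {j} → 1 ≤ j → j ≤ r → IsSign (pw j)
  pw-sign {j} 1≤j j≤r = sign-^ (signs j 1≤j j≤r) (mᵢ j + mᵢ (suc j))

  ζ-unit : ∀ {s} → 1 ≤ s → s ≤ r → Odd (nstar s) → IsUnit (ζᵢ s)
  ζ-unit 1≤s s≤r o = sign-≢0⇒unit (signs _ 1≤s s≤r) (E3 _ 1≤s s≤r o)

  -- (N5) forces one common value ω s on the odd positions inside block s: it restarts at
  -- ζ_{s-1} after an odd boundary n*_{s-1}, and picks up the factor ζ_{s-1}^{m_{s-1}+m_s}
  -- across an even one.  toUnit keeps ω a unit and is the identity wherever (E3) applies.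
  ω : ℕ → ℤ
  ωStep : ∀ b → Dec (Even (nstar (suc b))) → ℤ → ℤ

  ω zero          = 1ℤ
  ω (suc zero)    = 1ℤ
  ω (suc (suc b)) = ωStep b (2 ∣? nstar (suc b)) (ω (suc b))

  ωStep b (yes _) w = w ℤ.* toUnit (pw (suc b))
  ωStep b (no  _) _ = toUnit (ζᵢ (suc b))

  ω-even : ∀ b → Even (nstar (suc b)) → ω (suc (suc b)) ≡ ω (suc b) ℤ.* toUnit (pw (suc b))
  ω-even b e with 2 ∣? nstar (suc b)
  ... | yes _ = refl
  ... | no ¬e = ⊥-elim (¬e e)

  ω-odd : ∀ b → Odd (nstar (suc b)) → ω (suc (suc b)) ≡ toUnit (ζᵢ (suc b))
  ω-odd b o with 2 ∣? nstar (suc b)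
  ... | yes e = ⊥-elim (o e)
  ... | no  _ = refl

  ω-unit : ∀ b → IsUnit (ω b)
  ω-unit zero          = inj₁ refl
  ω-unit (suc zero)    = inj₁ refl
  ω-unit (suc (suc b)) = ωStep-unit (2 ∣? nstar (suc b)) (ω-unit (suc b))
    where
      ωStep-unit : ∀ d {w} → IsUnit w → IsUnit (ωStep b d w)
      ωStep-unit (yes _) u = unit-* u (toUnit-unit _)
      ωStep-unit (no  _) _ = toUnit-unit _

  ω-all-even : ∀ s → (∀ i → 1 ≤ i → i < suc s → Even (nstar i)) → ω (suc s) ≡ prodFrom (toUnit ∘ pw) 1 s
  ω-all-even zero    _     = refl
  ω-all-even (suc s) evens = begin
    ω (suc (suc s))                                     ≡⟨ ω-even s (evens (suc s) (s≤s z≤n) ≤-refl) ⟩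
    ω (suc s) ℤ.* toUnit (pw (suc s))                   ≡⟨ cong (ℤ._* toUnit (pw (suc s))) (ω-all-even s evens′) ⟩
    prodFrom (toUnit ∘ pw) 1 s ℤ.* toUnit (pw (suc s))  ≡⟨ sym (prodFrom-snoc (toUnit ∘ pw) 1 s) ⟩
    prodFrom (toUnit ∘ pw) 1 (suc s)                    ∎
    where
      open ≡-Reasoning
      evens′ : ∀ i → 1 ≤ i → i < suc s → Even (nstar i)
      evens′ i 1≤i i< = evens i 1≤i (m<n⇒m<1+n i<)

  ω-after-odd : ∀ t d → 1 ≤ t → Odd (nstar t) → (∀ i → t < i → i < suc (d + t) → Even (nstar i)) →
                ω (suc (d + t)) ≡ toUnit (ζᵢ t) ℤ.* prodFrom (toUnit ∘ pw) (suc t) d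
  ω-after-odd (suc t) zero    _   o _     = trans (ω-odd t o) (sym (ℤP.*-identityʳ _))
  ω-after-odd t       (suc d) 1≤t o evens = begin
      ω (suc (suc (d + t)))
    ≡⟨ ω-even (d + t) (evens (suc (d + t)) (s≤s (m≤n+m t d)) ≤-refl) ⟩
      ω (suc (d + t)) ℤ.* u (suc (d + t))
    ≡⟨ cong (ℤ._* u (suc (d + t))) (ω-after-odd t d 1≤t o (λ i t<i i< → evens i t<i (m<n⇒m<1+n i<))) ⟩
      (toUnit (ζᵢ t) ℤ.* prodFrom u (suc t) d) ℤ.* u (suc (d + t))
    ≡⟨ ℤP.*-assoc (toUnit (ζᵢ t)) _ _ ⟩
      toUnit (ζᵢ t) ℤ.* (prodFrom u (suc t) d ℤ.* u (suc (d + t)))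
    ≡⟨ cong (λ i → toUnit (ζᵢ t) ℤ.* (prodFrom u (suc t) d ℤ.* u (suc i))) (+-comm d t) ⟩
      toUnit (ζᵢ t) ℤ.* (prodFrom u (suc t) d ℤ.* u (suc t + d))
    ≡⟨ cong (toUnit (ζᵢ t) ℤ.*_) (sym (prodFrom-snoc u (suc t) d)) ⟩
      toUnit (ζᵢ t) ℤ.* prodFrom u (suc t) (suc d)
    ∎
    where
      open ≡-Reasoning
      u = toUnit ∘ pw

  -- (E3a) and (E3b) are exactly the two ways of unfolding ω s back to the last odd boundary.
  ζ-at-odd-end : ∀ {s} → 1 ≤ s → s ≤ r → Odd (nstar s) → Even (wsum (s ∸ 1) + mᵢ s * (nᵢ s ∸ 1)) → ζᵢ s ≡ ω s
  ζ-at-odd-end {suc s} 1≤s s≤r o ev with last-failure (λ i → 2 ∣? nstar i) (suc s)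
  ... | inj₁ evens = begin
    ζᵢ (suc s)                  ≡⟨ ζ≡ ⟩
    prodFrom pw 1 s             ≡⟨ sym (prodFrom-toUnit pw 1 s sign (subst (_≢ 0ℤ) ζ≡ (E3 _ 1≤s s≤r o))) ⟩
    prodFrom (toUnit ∘ pw) 1 s  ≡⟨ sym (ω-all-even s evens) ⟩
    ω (suc s)                   ∎
    where
      open ≡-Reasoning
      ζ≡ = E3a (suc s) 1≤s s≤r o evens
      sign : ∀ j → 1 ≤ j → j < suc s → IsSign (pw j)
      sign j 1≤j j< = pw-sign 1≤j (≤-trans (<⇒≤ j<) s≤r)
  ... | inj₂ (t , 1≤t , t<s , odd-t , evens) = begin
    ζᵢ (suc s)                                          ≡⟨ ζ≡ ⟩
    ζᵢ t ℤ.* prodFrom pw (suc t) d                      ≡⟨ cong₂ ℤ._*_ (sym (toUnit-id (ζ-unit 1≤t (≤-trans (<⇒≤ t<s) s≤r) odd-t)))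
                                                                       (sym (prodFrom-toUnit pw (suc t) d sign ≢0)) ⟩
    toUnit (ζᵢ t) ℤ.* prodFrom (toUnit ∘ pw) (suc t) d  ≡⟨ sym (ω-after-odd t d 1≤t odd-t (λ i t<i i< → evens i t<i (subst (i <_) d+t≡s i<))) ⟩
    ω (suc (d + t))                                     ≡⟨ cong ω d+t≡s ⟩
    ω (suc s)                                           ∎
    where
      open ≡-Reasoning
      d = s ∸ t
      d+t≡s : suc (d + t) ≡ suc s
      d+t≡s = cong suc (m∸n+n≡m (≤-pred t<s))
      ζ≡ = E3b (suc s) 1≤s s≤r o ev t 1≤t t<s odd-t evens
      ≢0 : prodFrom pw (suc t) d ≢ 0ℤ
      ≢0 p≡0 = E3 _ 1≤s s≤r o (trans ζ≡ (trans (cong (ζᵢ t ℤ.*_) p≡0) (ℤP.*-zeroʳ (ζᵢ t))))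
      sign : ∀ j → suc t ≤ j → j < suc t + d → IsSign (pw j)
      sign j t<j j< = pw-sign (≤-trans (s≤s z≤n) t<j)
                              (≤-trans (<⇒≤ (subst (j <_) (trans (cong suc (+-comm t d)) d+t≡s) j<)) s≤r)

  εInBlock : ℕ → ℕ → ℤ
  εInBlock k s with k ≟ nstar s | 2 ∣? k
  ... | yes _ | _     = ζᵢ s
  ... | no  _ | yes _ = evenSign (prefix k)
  ... | no  _ | no  _ = ω s

  εInBlock-end : ∀ {k s} → k ≡ nstar s → εInBlock k s ≡ ζᵢ s
  εInBlock-end {k} {s} k≡end with k ≟ nstar s
  ... | yes _   = refl
  ... | no  k≢ = ⊥-elim (k≢ k≡end)

  εInBlock-even : ∀ {k s} → k ≢ nstar s → Even k → εInBlock k s ≡ evenSign (prefix k)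
  εInBlock-even {k} {s} k≢end e with k ≟ nstar s | 2 ∣? k
  ... | yes k≡ | _     = ⊥-elim (k≢end k≡)
  ... | no  _  | yes _ = refl
  ... | no  _  | no ¬e = ⊥-elim (¬e e)

  εInBlock-odd : ∀ {k s} → k ≢ nstar s → Odd k → εInBlock k s ≡ ω s
  εInBlock-odd {k} {s} k≢end o with k ≟ nstar s | 2 ∣? k
  ... | yes k≡ | _     = ⊥-elim (k≢end k≡)
  ... | no  _  | yes e = ⊥-elim (o e)
  ... | no  _  | no  _ = refl

  εInBlock-sign : ∀ {k s} → 1 ≤ s → s ≤ r → IsSign (εInBlock k s)
  εInBlock-sign {k} {s} 1≤s s≤r with k ≟ nstar s | 2 ∣? k
  ... | yes _ | _     = signs s 1≤s s≤r
  ... | no  _ | yes _ = evenSign-sign (prefix k)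
  ... | no  _ | no  _ = inj₂ (ω-unit s)

  ε : ℕ → ℤ
  ε k = εInBlock k (block k)

  ε-InBlock : ∀ {k s} → InBlock k s → ε k ≡ εInBlock k s
  ε-InBlock {k} b = cong (εInBlock k) (block-unique b)

  ε-end : ∀ {s} → 1 ≤ s → s ≤ r → ε (nstar s) ≡ ζᵢ s
  ε-end 1≤s s≤r = trans (ε-InBlock (InBlock-last 1≤s s≤r)) (εInBlock-end refl)

  ε-sign : ∀ {k s} → InBlock k s → IsSign (ε k)
  ε-sign {k} b@(inBlock 1≤s s≤r _ _) = subst IsSign (sym (ε-InBlock b)) (εInBlock-sign {k} 1≤s s≤r)

  ε-even-≢0⇔ : ∀ {k s} → InBlock k s → Even k → (ε k ≢ 0ℤ) ⇔ Even (prefix k)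
  ε-even-≢0⇔ {k} {s} b@(inBlock 1≤s s≤r _ _) e with k ≟ nstar s
  ... | yes refl = subst₂ (λ x y → (x ≢ 0ℤ) ⇔ Even y) (sym (ε-end 1≤s s≤r)) (sym (prefix-end s≤r)) (E2 s 1≤s s≤r e)
  ... | no  k≢   = subst (λ x → (x ≢ 0ℤ) ⇔ Even (prefix k)) (sym (trans (ε-InBlock b) (εInBlock-even k≢ e)))
                         (evenSign-≢0⇔even (prefix k))

  ε-odd-≢0 : ∀ {k s} → InBlock k s → Odd k → ε k ≢ 0ℤ
  ε-odd-≢0 {k} {s} b@(inBlock 1≤s s≤r _ _) o with k ≟ nstar s
  ... | yes refl = subst (_≢ 0ℤ) (sym (ε-end 1≤s s≤r)) (E3 s 1≤s s≤r o)
  ... | no  k≢   = subst (_≢ 0ℤ) (sym (trans (ε-InBlock b) (εInBlock-odd k≢ o))) (unit⇒≢0 (ω-unit s))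

  ε-odd-at-start : ∀ {j s} → Odd j → 1 ≤ s → s ≤ r → nstar (s ∸ 1) ≡ j → ε j ≡ ω s
  ε-odd-at-start {s = suc zero}    o _ _   refl = ⊥-elim (o (2 ∣0))
  ε-odd-at-start {s = suc (suc b)} o _ s≤r refl = begin
    ε (nstar (suc b))    ≡⟨ ε-end (s≤s z≤n) b≤r ⟩
    ζᵢ (suc b)           ≡⟨ sym (toUnit-id (ζ-unit (s≤s z≤n) b≤r o)) ⟩
    toUnit (ζᵢ (suc b))  ≡⟨ sym (ω-odd b o) ⟩
    ω (suc (suc b))      ∎
    where
      open ≡-Reasoning
      b≤r = ≤-trans (n≤1+n _) s≤r

  ε-odd-in-block : ∀ {j s} → Odd j → 1 ≤ s → s ≤ r → nstar (s ∸ 1) ≤ j → j < nstar s → ε j ≡ ω s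
  ε-odd-in-block o 1≤s s≤r start≤j j<end with m≤n⇒m<n∨m≡n start≤j
  ... | inj₁ start<j = trans (ε-InBlock (inBlock 1≤s s≤r start<j (<⇒≤ j<end))) (εInBlock-odd (<⇒≢ j<end) o)
  ... | inj₂ start≡j = ε-odd-at-start o 1≤s s≤r start≡j

  ε-odd-InBlock : ∀ {k s} → InBlock k s → Odd k → Even (prefix (k ∸ 1)) → ε k ≡ ω s
  ε-odd-InBlock {k} {s} b@(inBlock 1≤s s≤r _ _) o ev with k ≟ nstar s
  ... | yes refl = trans (ε-end 1≤s s≤r) (ζ-at-odd-end 1≤s s≤r o (subst Even (prefix-before-end 1≤s s≤r) ev))
  ... | no  k≢   = trans (ε-InBlock b) (εInBlock-odd k≢ o)

  ε-recursion-interior : ∀ {i s} e → Even (suc i) → InBlock (suc i) s → suc i ≢ nstar s → Even (prefix (suc i)) →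
                         ε i ℤ.* (ε (suc i) ℤ.^ e) ≡ ω s
  ε-recursion-interior {i} {s} e ev b@(inBlock 1≤s s≤r start<si si≤end) si≢end evp = begin
    ε i ℤ.* (ε (suc i) ℤ.^ e)  ≡⟨ cong (λ x → ε i ℤ.* (x ℤ.^ e)) ε-si≡1 ⟩
    ε i ℤ.* (1ℤ ℤ.^ e)         ≡⟨ cong (ε i ℤ.*_) (ℤP.^-zeroˡ e) ⟩
    ε i ℤ.* 1ℤ                 ≡⟨ ℤP.*-identityʳ (ε i) ⟩
    ε i                        ≡⟨ ε-odd-in-block (even-suc⇒odd ev) 1≤s s≤r (≤-pred start<si) si≤end ⟩
    ω s                        ∎
    where
      open ≡-Reasoning
      ε-si≡1 : ε (suc i) ≡ 1ℤ
      ε-si≡1 = trans (ε-InBlock b) (trans (εInBlock-even {s = s} si≢end ev) (evenSign-even evp))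

  ε-recursion-boundary : ∀ {i b} → Even (suc i) → suc (suc b) ≤ r → nstar (suc b) ≡ suc i → Even (prefix (suc i)) →
                         ε i ℤ.* (ε (suc i) ℤ.^ (a (suc (suc i)) + a (suc i))) ≡ ω (suc (suc b))
  ε-recursion-boundary {i} {b} ev s≤r end≡ evp = begin
      ε i ℤ.* (ε (suc i) ℤ.^ (a (suc (suc i)) + a (suc i)))
    ≡⟨ cong₂ ℤ._*_ (ε-odd-in-block (even-suc⇒odd ev) (s≤s z≤n) b≤r start≤i i<end) (cong₂ ℤ._^_ ε-si≡ζ exponent≡) ⟩
      ω (suc b) ℤ.* pw (suc b)
    ≡⟨ cong (ω (suc b) ℤ.*_) (sym (toUnit-id (unit-^ ζ-unit′ (mᵢ (suc b) + mᵢ (suc (suc b)))))) ⟩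
      ω (suc b) ℤ.* toUnit (pw (suc b))
    ≡⟨ sym (ω-even b (subst Even (sym end≡) ev)) ⟩
      ω (suc (suc b))
    ∎
    where
      open ≡-Reasoning
      b≤r : suc b ≤ r
      b≤r = ≤-trans (n≤1+n _) s≤r
      start≤i : nstar b ≤ i
      start≤i = ≤-pred (subst (nstar b <_) end≡ (nstar-<-suc b≤r))
      i<end : i < nstar (suc b)
      i<end = subst (i <_) (sym end≡) ≤-refl
      ε-si≡ζ : ε (suc i) ≡ ζᵢ (suc b)
      ε-si≡ζ = trans (cong ε (sym end≡)) (ε-end (s≤s z≤n) b≤r)
      exponent≡ : a (suc (suc i)) + a (suc i) ≡ mᵢ (suc b) + mᵢ (suc (suc b))
      exponent≡ = trans (+-comm (a (suc (suc i))) _) (cong₂ _+_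
        (trans (cong a (sym end≡)) (a-InBlock (InBlock-last (s≤s z≤n) b≤r)))
        (a-InBlock (inBlock (s≤s z≤n) s≤r (subst (_< suc (suc i)) (sym end≡) ≤-refl)
                            (subst (λ x → suc x ≤ nstar (suc (suc b))) end≡ (nstar-<-suc s≤r)))))
      ζ-unit′ : IsUnit (ζᵢ (suc b))
      ζ-unit′ = sign-≢0⇒unit (signs _ (s≤s z≤n) b≤r)
        (Equivalence.from (E2 (suc b) (s≤s z≤n) b≤r (subst Even (sym end≡) ev))
                          (subst Even (trans (cong prefix (sym end≡)) (prefix-end b≤r)) evp))

  ε-recursion : ∀ {i s} → Even (suc i) → InBlock (suc (suc i)) s → Even (prefix (suc i)) →
                ε i ℤ.* (ε (suc i) ℤ.^ (a (suc (suc i)) + a (suc i))) ≡ ω s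
  ε-recursion {i} {s} ev (inBlock 1≤s s≤r start<ssi ssi≤end) evp with m≤n⇒m<n∨m≡n (≤-pred start<ssi)
  ... | inj₁ start<si = ε-recursion-interior (a (suc (suc i)) + a (suc i)) ev
                          (inBlock 1≤s s≤r start<si (<⇒≤ ssi≤end)) (<⇒≢ ssi≤end) evp
  ... | inj₂ start≡si = at-boundary s s≤r start≡si
    where
      at-boundary : ∀ s → s ≤ r → nstar (s ∸ 1) ≡ suc i → ε i ℤ.* (ε (suc i) ℤ.^ (a (suc (suc i)) + a (suc i))) ≡ ω s
      at-boundary (suc zero)    _   ()
      at-boundary (suc (suc b)) s≤r end≡ = ε-recursion-boundary ev s≤r end≡ evp

  ε-N5 : ∀ {i} → suc (suc i) ≤ n → Odd (suc (suc i)) → Even (prefix (suc i)) →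
         ε (suc (suc i)) ≡ ε i ℤ.* (ε (suc i) ℤ.^ (a (suc (suc i)) + a (suc i)))
  ε-N5 k≤n o evp = trans (ε-odd-InBlock b o evp) (sym (ε-recursion (odd-suc⇒even o) b evp))
    where b = block-InBlock (s≤s z≤n) k≤n

  ε-1 : ε 1 ≡ 1ℤ
  ε-1 = ε-odd-InBlock (inBlock ≤-refl r≥1 ≤-refl (nstar-mono-< ≤-refl r≥1)) odd-1 (2 ∣0)

  aVec : Vec ℕ n
  aVec = fromFun a 1 n

  εVec : Vec ℤ n
  εVec = fromFun ε 1 n

  get-a : ∀ {i} → 1 ≤ i → i ≤ n → get 0 aVec i ≡ a i
  get-a = get-fromFun₁ 0 a

  get-ε : ∀ {i} → 1 ≤ i → i ≤ n → get 0ℤ εVec i ≡ ε i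
  get-ε = get-fromFun₁ 0ℤ ε

  εVec-N5 : ∀ i → 3 ≤ i → i ≤ n → Odd i → Even (psum aVec (i ∸ 1)) →
            get 0ℤ εVec i ≡ get 0ℤ εVec (i ∸ 2) ℤ.* (get 0ℤ εVec (i ∸ 1) ℤ.^ (get 0 aVec i + get 0 aVec (i ∸ 1)))
  εVec-N5 (suc zero)          (s≤s ())
  εVec-N5 (suc (suc zero))    (s≤s (s≤s ()))
  εVec-N5 (suc (suc (suc i))) _ k≤n o evp
    rewrite get-ε {suc (suc (suc i))} (s≤s z≤n) k≤n
          | get-ε {suc i} (s≤s z≤n) (≤-trans (n≤1+n _) (≤-trans (n≤1+n _) k≤n))
          | get-ε {suc (suc i)} (s≤s z≤n) (≤-trans (n≤1+n _) k≤n)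
          | get-a {suc (suc (suc i))} (s≤s z≤n) k≤n
          | get-a {suc (suc i)} (s≤s z≤n) (≤-trans (n≤1+n _) k≤n)
    = ε-N5 k≤n o (subst Even (psum-fromFun a 1 (suc (suc i)) (≤-trans (n≤1+n _) k≤n)) evp)

  naive : NaiveEGK n
  naive = record
    { a     = aVec
    ; ε     = εVec
    ; signs = λ i 1≤i i≤n → subst IsSign (sym (get-ε 1≤i i≤n)) (ε-sign (block-InBlock 1≤i i≤n))
    ; N1    = λ i 1≤i i<n → subst₂ _≤_ (sym (get-a 1≤i (<⇒≤ i<n))) (sym (get-a (s≤s z≤n) i<n))
                                        (a-mono 1≤i (n≤1+n i) i<n)
    ; N2    = λ i 1≤i i≤n e → subst₂ (λ x y → (x ≢ 0ℤ) ⇔ Even y) (sym (get-ε 1≤i i≤n)) (sym (psum-fromFun a 1 i i≤n))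
                                     (ε-even-≢0⇔ (block-InBlock 1≤i i≤n) e)
    ; N3    = λ i 1≤i i≤n o → subst (_≢ 0ℤ) (sym (get-ε 1≤i i≤n)) (ε-odd-≢0 (block-InBlock 1≤i i≤n) o)
    ; N4    = λ 1≤n → trans (get-ε ≤-refl 1≤n) ε-1
    ; N5    = εVec-N5
    }

  naive-Υ≡ : Υ≡ naive G
  naive-Υ≡ = record
    { values-inc = E1-inc
    ; values-⊆   = λ s 1≤s s≤r → nstar s , 1≤end 1≤s s≤r , nstar≤n s≤r ,
                                 trans (get-a (1≤end 1≤s s≤r) (nstar≤n s≤r)) (a-InBlock (InBlock-last 1≤s s≤r))
    ; values-⊇   = λ i 1≤i i≤n → block i , InBlock.1≤s (block-InBlock 1≤i i≤n) , InBlock.s≤r (block-InBlock 1≤i i≤n) ,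
                                 get-a 1≤i i≤n
    ; mult       = λ s 1≤s s≤r → sym (count-a 1≤s s≤r)
    ; signs-eq   = λ s 1≤s s≤r → sym (trans (get-ε (1≤end 1≤s s≤r) (nstar≤n s≤r)) (ε-end 1≤s s≤r))
    }
    where
      1≤end : ∀ {s} → 1 ≤ s → s ≤ r → 1 ≤ nstar s
      1≤end 1≤s s≤r = ≤-trans (s≤s z≤n) (InBlock.start<k (InBlock-last 1≤s s≤r))

proposition6p3 : (n : ℕ) → (G : EGK n) → ∃ λ (H : NaiveEGK n) → Υ≡ H G
proposition6p3 n G = naive , naive-Υ≡
  where open Construction G
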